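{- Let $n \ge 1$ and let $i = \frac{3^n+1}{2} + \frac{3^j-1}{2} + \frac{3^k-1}{2}$, where $0 \le j \le k \le n-1$ are integers. Then $$\binom{3i - \frac{3^n-1}{2}}{i - \frac{3^n+1}{2}} \equiv \begin{cases} 1 \pmod 3 & \text{if } j = k, \\ 2 \pmod 3 & \text{if } j < k. \end{cases}$$ -}

module Defs where

open import Data.Nat using (ℕ; _∸_; _^_; _+_)
open import Data.Nat.DivMod using (_/_)

-- half m = (3^m - 1)/2  (an exact division, since 3^m is odd)
half : ℕ → ℕ
half m = (3 ^ m ∸ 1) / 2

halfPlus : ℕ → ℕ
halfPlus m = (3 ^ m + 1) / 2

-- Write [m] for the base-3 repunit 11…1 with m digits, so that (3^m - 1)/2 = [m] and
-- (3^m + 1)/2 = [m] + 1. The binomial coefficient is then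
-- (3^n + [j+1] + [k+1]) C ([j] + [k]), and both arguments have transparent base-3 digits.
-- By Lucas' theorem it is congruent mod 3 to the product of the digitwise binomials:
-- (2 C 2)^j · (2 C 0) = 1 when j = k, and (2 C 2)^j · (2 C 1) · (1 C 1)^(k-j-1) · (1 C 0) = 2
-- when j < k.
module Submission where

open import Defs
open import Data.Nat using (ℕ; zero; suc; _+_; _*_; _∸_; _≤_; _<_; _%_; _^_; z<s; s<s)
open import Data.Nat.Combinatorics using (_C_; nC1≡n; k>n⇒nCk≡0; nCk+nC[k+1]≡[n+1]C[k+1])
open import Data.Nat.DivMod using (%-distribˡ-+; %-distribˡ-*; [m+kn]%n≡m%n; m*n/n≡m; _/_)
open import Data.Nat.Properties
  using (+-comm; +-identityʳ; *-identityʳ; *-distribʳ-+; ≤-trans; *-suc; +-assoc; m+n∸m≡n; m≤m+n; *-monoʳ-≤; <-≤-trans)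
open import Data.Nat.Tactic.RingSolver using (solve-∀)
open import Data.Product using (_×_; _,_)
open import Relation.Binary.PropositionalEquality
open ≡-Reasoning

infix 4 _≡₃_

_≡₃_ : ℕ → ℕ → Set
m ≡₃ n = m % 3 ≡ n % 3

+-cong₃ : ∀ {a b c d} → a ≡₃ b → c ≡₃ d → a + c ≡₃ b + d
+-cong₃ {a} {b} {c} {d} a≡b c≡d = begin
  (a + c) % 3            ≡⟨ %-distribˡ-+ a c 3 ⟩
  (a % 3 + c % 3) % 3    ≡⟨ cong₂ (λ x y → (x + y) % 3) a≡b c≡d ⟩
  (b % 3 + d % 3) % 3    ≡⟨ %-distribˡ-+ b d 3 ⟨
  (b + d) % 3            ∎

*-congʳ₃ : ∀ {a b} c → a ≡₃ b → a * c ≡₃ b * c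
*-congʳ₃ {a} {b} c a≡b = begin
  (a * c) % 3            ≡⟨ %-distribˡ-* a c 3 ⟩
  (a % 3 * (c % 3)) % 3  ≡⟨ cong (λ x → (x * (c % 3)) % 3) a≡b ⟩
  (b % 3 * (c % 3)) % 3  ≡⟨ %-distribˡ-* b c 3 ⟨
  (b * c) % 3            ∎

m+k*3≡₃m : ∀ m k → m + k * 3 ≡₃ m
m+k*3≡₃m m k = [m+kn]%n≡m%n m k 3

pascal : ∀ n k → suc n C suc k ≡ n C k + n C suc k
pascal n k = sym (nCk+nC[k+1]≡[n+1]C[k+1] n k)

-- (1 + x)^3 = 1 + 3x + 3x² + x³, read off coefficientwise.
pascal³ : ∀ n k →
  (3 + n) C (3 + k) ≡ n C k + n C (3 + k) + (n C (1 + k) + n C (2 + k)) * 3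
pascal³ n k = begin
  (3 + n) C (3 + k)
    ≡⟨ pascal (2 + n) (2 + k) ⟩
  (2 + n) C (2 + k) + (2 + n) C (3 + k)
    ≡⟨ cong₂ _+_ (pascal (1 + n) (1 + k)) (pascal (1 + n) (2 + k)) ⟩
  ((1 + n) C (1 + k) + (1 + n) C (2 + k)) + ((1 + n) C (2 + k) + (1 + n) C (3 + k))
    ≡⟨ cong₂ _+_ (cong₂ _+_ (pascal n k) (pascal n (1 + k)))
                 (cong₂ _+_ (pascal n (1 + k)) (pascal n (2 + k))) ⟩
  ((n C k + n C (1 + k)) + (n C (1 + k) + n C (2 + k)))
    + ((n C (1 + k) + n C (2 + k)) + (n C (2 + k) + n C (3 + k)))
    ≡⟨ regroup (n C k) (n C (1 + k)) (n C (2 + k)) (n C (3 + k)) ⟩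
  n C k + n C (3 + k) + (n C (1 + k) + n C (2 + k)) * 3 ∎
  where
  regroup : ∀ a b c d → ((a + b) + (b + c)) + ((b + c) + (c + d)) ≡ a + d + (b + c) * 3
  regroup = solve-∀

[3+n]C1≡nC1+3 : ∀ n → (3 + n) C 1 ≡ n C 1 + 1 * 3
[3+n]C1≡nC1+3 n = begin
  (3 + n) C 1       ≡⟨ nC1≡n (3 + n) ⟩
  3 + n             ≡⟨ +-comm 3 n ⟩
  n + 1 * 3         ≡⟨ cong (_+ 1 * 3) (nC1≡n n) ⟨
  n C 1 + 1 * 3     ∎

[3+n]C2≡nC2+[1+n]*3 : ∀ n → (3 + n) C 2 ≡ n C 2 + (1 + n) * 3
[3+n]C2≡nC2+[1+n]*3 n = begin
  (3 + n) C 2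
    ≡⟨ pascal (2 + n) 1 ⟩
  (2 + n) C 1 + (2 + n) C 2
    ≡⟨ cong ((2 + n) C 1 +_) (pascal (1 + n) 1) ⟩
  (2 + n) C 1 + ((1 + n) C 1 + (1 + n) C 2)
    ≡⟨ cong (λ x → (2 + n) C 1 + ((1 + n) C 1 + x)) (pascal n 1) ⟩
  (2 + n) C 1 + ((1 + n) C 1 + (n C 1 + n C 2))
    ≡⟨ cong₂ (λ a b → a + (b + (n C 1 + n C 2))) (nC1≡n (2 + n)) (nC1≡n (1 + n)) ⟩
  (2 + n) + ((1 + n) + (n C 1 + n C 2))
    ≡⟨ cong (λ x → (2 + n) + ((1 + n) + (x + n C 2))) (nC1≡n n) ⟩
  (2 + n) + ((1 + n) + (n + n C 2))
    ≡⟨ regroup n (n C 2) ⟩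
  n C 2 + (1 + n) * 3 ∎
  where
  regroup : ∀ n c → (2 + n) + ((1 + n) + (n + c)) ≡ c + (1 + n) * 3
  regroup = solve-∀

pascal³-low : ∀ n s → s < 3 → (3 + n) C s ≡₃ n C s
pascal³-low n 0 _ = refl
pascal³-low n 1 _ = trans (cong (_% 3) ([3+n]C1≡nC1+3 n)) (m+k*3≡₃m (n C 1) 1)
pascal³-low n 2 _ = trans (cong (_% 3) ([3+n]C2≡nC2+[1+n]*3 n)) (m+k*3≡₃m (n C 2) (1 + n))
pascal³-low n (suc (suc (suc _))) (s<s (s<s (s<s ())))

3[1+a]+r : ∀ a r → 3 * suc a + r ≡ 3 + (3 * a + r)
3[1+a]+r a r = trans (cong (_+ r) (*-suc 3 a)) (+-assoc 3 (3 * a) r)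

lucas : ∀ a b r s → r < 3 → s < 3 → (3 * a + r) C (3 * b + s) ≡₃ (a C b) * (r C s)
lucas zero zero r s _ _ = cong (_% 3) (sym (+-identityʳ (r C s)))
lucas zero (suc b) r s r<3 _ = cong (_% 3) (k>n⇒nCk≡0 r<3*[1+b]+s)
  where
  r<3*[1+b]+s : r < 3 * suc b + s
  r<3*[1+b]+s = <-≤-trans r<3 (≤-trans (*-monoʳ-≤ 3 z<s) (m≤m+n (3 * suc b) s))
lucas (suc a) zero r s r<3 s<3 = begin
  ((3 * suc a + r) C s) % 3   ≡⟨ cong (λ m → (m C s) % 3) (3[1+a]+r a r) ⟩
  ((3 + (3 * a + r)) C s) % 3 ≡⟨ pascal³-low (3 * a + r) s s<3 ⟩
  ((3 * a + r) C s) % 3       ≡⟨ lucas a zero r s r<3 s<3 ⟩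
  1 * (r C s) % 3             ∎
lucas (suc a) (suc b) r s r<3 s<3 = begin
  ((3 * suc a + r) C (3 * suc b + s)) % 3
    ≡⟨ cong₂ (λ m l → (m C l) % 3) (3[1+a]+r a r) (3[1+a]+r b s) ⟩
  ((3 + (3 * a + r)) C (3 + (3 * b + s))) % 3
    ≡⟨ cong (_% 3) (pascal³ (3 * a + r) (3 * b + s)) ⟩
  (m C l + m C (3 + l) + (m C (1 + l) + m C (2 + l)) * 3) % 3
    ≡⟨ m+k*3≡₃m (m C l + m C (3 + l)) (m C (1 + l) + m C (2 + l)) ⟩
  (m C l + m C (3 + l)) % 3
    ≡⟨ +-cong₃ {m C l} {(a C b) * (r C s)} {m C (3 + l)} {(a C suc b) * (r C s)}
               (lucas a b r s r<3 s<3) lucas-next ⟩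
  ((a C b) * (r C s) + (a C suc b) * (r C s)) % 3
    ≡⟨ cong (_% 3) (sym (*-distribʳ-+ (r C s) (a C b) (a C suc b))) ⟩
  (a C b + a C suc b) * (r C s) % 3
    ≡⟨ cong (λ x → x * (r C s) % 3) (pascal a b) ⟨
  (suc a C suc b) * (r C s) % 3 ∎
  where
  m = 3 * a + r
  l = 3 * b + s
  lucas-next : m C (3 + l) ≡₃ (a C suc b) * (r C s)
  lucas-next = subst (λ l′ → m C l′ ≡₃ (a C suc b) * (r C s))
                     (3[1+a]+r b s) (lucas a (suc b) r s r<3 s<3)

lucas′ : ∀ a b r s {m l} → m ≡ 3 * a + r → l ≡ 3 * b + s → r < 3 → s < 3 →
         m C l ≡₃ (a C b) * (r C s)
lucas′ a b r s refl refl = lucas a b r s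

repunit : ℕ → ℕ
repunit zero    = 0
repunit (suc m) = 3 * repunit m + 1

3^m≡1+2*repunit : ∀ m → 3 ^ m ≡ 1 + repunit m * 2
3^m≡1+2*repunit zero    = refl
3^m≡1+2*repunit (suc m) = trans (cong (3 *_) (3^m≡1+2*repunit m)) (expand (repunit m))
  where
  expand : ∀ x → 3 * (1 + x * 2) ≡ 1 + (3 * x + 1) * 2
  expand = solve-∀

half≡repunit : ∀ m → half m ≡ repunit m
half≡repunit m = trans (cong (λ t → (t ∸ 1) / 2) (3^m≡1+2*repunit m)) (m*n/n≡m (repunit m) 2)

halfPlus≡1+repunit : ∀ m → halfPlus m ≡ 1 + repunit m
halfPlus≡1+repunit m = begin
  (3 ^ m + 1) / 2               ≡⟨ cong (λ t → (t + 1) / 2) (3^m≡1+2*repunit m) ⟩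
  (1 + repunit m * 2 + 1) / 2   ≡⟨ cong (_/ 2) (regroup (repunit m)) ⟩
  (1 + repunit m) * 2 / 2       ≡⟨ m*n/n≡m (1 + repunit m) 2 ⟩
  1 + repunit m                 ∎
  where
  regroup : ∀ x → 1 + x * 2 + 1 ≡ (1 + x) * 2
  regroup = solve-∀

-- In base 3: 1 followed by k+1 ones, over k ones.
repunit-ones : ∀ m k → k < m → (3 ^ m + repunit (suc k)) C repunit k ≡₃ 1
repunit-ones m       zero    _         = refl
repunit-ones (suc m) (suc k) (s<s k<m) = begin
  ((3 ^ suc m + repunit (suc (suc k))) C repunit (suc k)) % 3
    ≡⟨ lucas′ top (repunit k) 1 1 (regroup (3 ^ m) (repunit (suc k))) refl (s<s z<s) (s<s z<s) ⟩
  ((top C repunit k) * 1) % 3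
    ≡⟨ cong (_% 3) (*-identityʳ (top C repunit k)) ⟩
  (top C repunit k) % 3
    ≡⟨ repunit-ones m k k<m ⟩
  1 ∎
  where
  top = 3 ^ m + repunit (suc k)
  regroup : ∀ p x → 3 * p + (3 * x + 1) ≡ 3 * (p + x) + 1
  regroup = solve-∀

repunitBinomial : ℕ → ℕ → ℕ → ℕ
repunitBinomial n j k = (3 ^ n + repunit (suc j) + repunit (suc k)) C (repunit j + repunit k)

-- Lucas on the lowest digits, 2 over 2.
repunitBinomial-suc : ∀ n j k → repunitBinomial (suc n) (suc j) (suc k) ≡₃ repunitBinomial n j k
repunitBinomial-suc n j k = begin
  repunitBinomial (suc n) (suc j) (suc k) % 3
    ≡⟨ lucas′ (3 ^ n + repunit (suc j) + repunit (suc k)) (repunit j + repunit k) 2 2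
         (top-digits (3 ^ n) (repunit (suc j)) (repunit (suc k)))
         (bottom-digits (repunit j) (repunit k)) (s<s (s<s z<s)) (s<s (s<s z<s)) ⟩
  (repunitBinomial n j k * 1) % 3
    ≡⟨ cong (_% 3) (*-identityʳ (repunitBinomial n j k)) ⟩
  repunitBinomial n j k % 3 ∎
  where
  top-digits : ∀ p x y → 3 * p + (3 * x + 1) + (3 * y + 1) ≡ 3 * (p + x + y) + 2
  top-digits = solve-∀
  bottom-digits : ∀ x y → (3 * x + 1) + (3 * y + 1) ≡ 3 * (x + y) + 2
  bottom-digits = solve-∀

repunitBinomial-diag : ∀ n j → j < n → repunitBinomial n j j ≡₃ 1
repunitBinomial-diag n       zero    _         = refl
repunitBinomial-diag (suc n) (suc j) (s<s j<n) =
  trans (repunitBinomial-suc n j j) (repunitBinomial-diag n j j<n)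

repunitBinomial-offdiag : ∀ n j k → j < k → k < n → repunitBinomial n j k ≡₃ 2
repunitBinomial-offdiag (suc n) zero (suc k) _ (s<s k<n) = begin
  repunitBinomial (suc n) 0 (suc k) % 3
    ≡⟨ lucas′ (3 ^ n + repunit (suc k)) (repunit k) 2 1
         (top-digits (3 ^ n) (repunit (suc k))) refl (s<s (s<s z<s)) (s<s z<s) ⟩
  (((3 ^ n + repunit (suc k)) C repunit k) * 2) % 3
    ≡⟨ *-congʳ₃ {(3 ^ n + repunit (suc k)) C repunit k} {1} 2 (repunit-ones n k k<n) ⟩
  2 ∎
  where
  top-digits : ∀ p x → 3 * p + 1 + (3 * x + 1) ≡ 3 * (p + x) + 2
  top-digits = solve-∀
repunitBinomial-offdiag (suc n) (suc j) (suc k) (s<s j<k) (s<s k<n) =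
  trans (repunitBinomial-suc n j k) (repunitBinomial-offdiag n j k j<k k<n)

binomial≡repunitBinomial : ∀ n j k →
  let i = 1 + repunit n + repunit j + repunit k in
  (3 * i ∸ repunit n) C (i ∸ (1 + repunit n)) ≡ repunitBinomial n j k
binomial≡repunitBinomial n j k = cong₂ _C_ top bottom
  where
  R = repunit n
  top : 3 * (1 + R + repunit j + repunit k) ∸ R ≡ 3 ^ n + repunit (suc j) + repunit (suc k)
  top = begin
    3 * (1 + R + repunit j + repunit k) ∸ R
      ≡⟨ cong (_∸ R) (regroup R (repunit j) (repunit k)) ⟩
    R + ((1 + R * 2) + repunit (suc j) + repunit (suc k)) ∸ R
      ≡⟨ m+n∸m≡n R _ ⟩
    (1 + R * 2) + repunit (suc j) + repunit (suc k)
      ≡⟨ cong (λ t → t + repunit (suc j) + repunit (suc k)) (3^m≡1+2*repunit n) ⟨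
    3 ^ n + repunit (suc j) + repunit (suc k) ∎
    where
    regroup : ∀ r x y → 3 * (1 + r + x + y) ≡ r + ((1 + r * 2) + (3 * x + 1) + (3 * y + 1))
    regroup = solve-∀
  bottom : 1 + R + repunit j + repunit k ∸ (1 + R) ≡ repunit j + repunit k
  bottom = trans (cong (_∸ (1 + R)) (+-assoc (1 + R) (repunit j) (repunit k)))
                 (m+n∸m≡n (1 + R) _)

theorem5 : (n j k : ℕ) → 1 ≤ n → j ≤ k → k < n →
    let i = halfPlus n + half j + half k in
    ((j ≡ k → ((3 * i ∸ half n) C (i ∸ halfPlus n)) % 3 ≡ 1)
    × (j < k → ((3 * i ∸ half n) C (i ∸ halfPlus n)) % 3 ≡ 2))
-- 1 ≤ n and j ≤ k are implied by k < n and the case hypotheses.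
theorem5 n j k _ _ k<n
  rewrite halfPlus≡1+repunit n | half≡repunit n | half≡repunit j | half≡repunit k
        | binomial≡repunitBinomial n j k
  = (λ { refl → repunitBinomial-diag n j k<n })
  , (λ j<k → repunitBinomial-offdiag n j k j<k k<n)
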